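{- Let $k\ge 2$ and let $\alpha$ be a node of $\mathcal T_k$. (1) If $\alpha$ is the terminal node of a maximal path $\beta=\gamma_0,\gamma_1,\dots,\gamma_r=\alpha$ in $\mathcal T_k$ (each $\gamma_{t+1}$ a child of $\gamma_t$) such that $i(\beta)>1$ and $i(\gamma_t)=1$ for all $t\ge 1$, and which cannot be extended (i.e. $\alpha$ has no child $\gamma$ with $i(\gamma)=1$), then $A_{i(\alpha)}(\alpha)=0$. (2) If $\alpha=a_{k-1}\cdots a_1$ with $a_{k-1}=1$ and $a_j=0$ for $j=1,\dots,k-2$, then $A_{i(\alpha)}(\alpha)=0$.
   Context: A $k$-germ ($k\ge 2$) is a string $\alpha=a_{k-1}a_{k-2}\cdots a_1$ of nonnegative integers with $a_{k-1}\in\{0,1\}$ and $0\le a_{i-1}\le a_i+1$ for $1<i<k$. For $\alpha\neq 0^{k-1}$ let $i(\alpha)$ be the index of the rightmost nonzero entry of $\alpha$, and let the parent $\beta$ of $\alpha$ be the $k$-germ equal to $\alpha$ except that $b_{i(\alpha)}=a_{i(\alpha)}-1$; this makes the $k$-germs the nodes of a tree $\mathcal T_k$ rooted at $0^{k-1}$ (the children of a node are the germs whose parent it is). The $n$-nest $F(\alpha)$ ($n=2k+1$) is defined recursively along $\mathcal T_k$: $F(0^{k-1})=0\,1\,2\cdots(k-1)\,k\,k\,(k-1)\cdots 2\,1$; for $\alpha\ne 0^{k-1}$ with parent $\beta$ and $i=i(\alpha)$, write $F(\beta)=W^i|M|Z^i$ where $W^i$, $Z^i$ are the leftmost and rightmost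 substrings of length $i$, let $c$ be the leftmost entry of $M$, and split $M=X|Y$ where $Y$ starts at the (leftmost) entry equal to $c+1$ in $M$; then $F(\alpha)=W^i|Y|X|Z^i$. Each $j\in[1,k]$ appears exactly twice in $F(\alpha)$, at positions $p_j<q_j$; the signature entries are $A_j(\alpha)=\lfloor (q_j-p_j)/2\rfloor$ for $j\in[1,k-1]$ (the number of integers both of whose appearances lie strictly between the two appearances of $j$). -}

module Defs where

open import Data.Nat using (ℕ; zero; suc; _+_; _∸_; _≤_; _<_; ⌊_/2⌋)
open import Data.Nat.Properties using (_≟_)
open import Data.Bool using (Bool; true; false; if_then_else_)
open import Data.List using (List; []; _∷_; _++_; take; drop; length; reverse; map; upTo; break)
open import Data.Nat.ListAction using (sum)
open import Relation.Nullary using (yes; no)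
open import Data.Product using (_×_; _,_)
open import Relation.Binary.PropositionalEquality using (_≡_; _≢_)

-- CONVENTION: a k-germ  a_{k-1} a_{k-2} ... a_1  is represented by the list
--   [ a_1 , a_2 , ... , a_{k-1} ]
-- (i.e. the paper's string read right to left), so that entry j is at position j-1.

-- 1-based entry access:  entry α j = a_j  (0 outside the range)
entry : List ℕ → ℕ → ℕ
entry []       _             = 0
entry (x ∷ xs) zero          = 0
entry (x ∷ xs) (suc zero)    = x
entry (x ∷ xs) (suc (suc j)) = entry xs (suc j)

IsGerm : ℕ → List ℕ → Set
IsGerm k α =
  (length α ≡ k ∸ 1) ×
  (entry α (k ∸ 1) ≤ 1) ×
  (∀ i → 1 < i → i < k → entry α (i ∸ 1) ≤ entry α i + 1)

allZero : List ℕ → Bool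
allZero []          = true
allZero (zero ∷ xs) = allZero xs
allZero (suc _ ∷ _) = false

IsNonzero : List ℕ → Set
IsNonzero α = allZero α ≡ false

-- i(α): index of the rightmost nonzero entry of the string, i.e. the smallest j with a_j ≠ 0
-- (only meaningful for nonzero α)
iIdx : List ℕ → ℕ
iIdx []          = 0
iIdx (zero ∷ xs) = suc (iIdx xs)
iIdx (suc _ ∷ _) = 1

parent : List ℕ → List ℕ
parent []          = []
parent (zero ∷ xs) = zero ∷ parent xs
parent (suc a ∷ xs) = a ∷ xs

IsChild : ℕ → List ℕ → List ℕ → Set
IsChild k γ β = IsGerm k γ × IsNonzero γ × (parent γ ≡ β)

baseNest : ℕ → List ℕ
baseNest k = upTo (suc k) ++ reverse (map suc (upTo k))

-- The step: F(β) = W^i | M | Z^i,  c = first entry of M,  M = X | Y with Y starting at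
-- the leftmost entry of M equal to c+1;  result  W^i | Y | X | Z^i.
step : ℕ → List ℕ → List ℕ
step i L with take i L | drop i L
... | W | R with take (length R ∸ i) R | drop (length R ∸ i) R
...   | []      | Z = L
...   | (c ∷ m) | Z with break (λ x → x ≟ suc c) (c ∷ m)
...     | X , Y = W ++ Y ++ X ++ Z

-- F by recursion along T_k, with fuel (the sum of the entries strictly decreases along parent)
nestFuel : ℕ → ℕ → List ℕ → List ℕ
nestFuel k zero    α = baseNest k
nestFuel k (suc n) α =
  if allZero α then baseNest k else step (iIdx α) (nestFuel k n (parent α))

F : ℕ → List ℕ → List ℕ
F k α = nestFuel k (sum α) α

positionsFrom : ℕ → ℕ → List ℕ → List ℕ
positionsFrom j o []       = []
positionsFrom j o (x ∷ xs) with x ≟ j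
... | yes _ = o ∷ positionsFrom j (suc o) xs
... | no  _ = positionsFrom j (suc o) xs

sigA : ℕ → ℕ → List ℕ → ℕ
sigA k j α with positionsFrom j 0 (F k α)
... | p ∷ q ∷ _ = ⌊ (q ∸ p) /2⌋
... | _         = 0

-- Germs are stored as a₁ ∷ a₂ ∷ …, so the recursion for F peels off a₁.  A leading a₁ = 0
-- frames the nest, F(0α) = 0 ∷ (F(α) + 1) ++ [1], and each further unit of a₁ rotates the middle
-- block of the frame once; hence F(mα) = frame (rotateᵐ F(α)).
-- (2) By induction along the framings, the two copies of k − 1 in F(0⋯01) stay adjacent.
-- (1) A child along index 1 exists exactly while a₁ ≤ a₂, so the end of the path is
-- α = (b+1) b β′.  Let K = F(β′), whose only 0 is its head, and K′ = rotateᵇ K, so F(bβ′) = frame K′.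
-- The first rotation of frame K′ cuts at the image of the 0 of K′, leaving K′ + 1 with a marker
-- 1 0 at a seam of the cyclic word; the next b rotations move the blocks as the b rotations of K
-- did, which brings the seam, and with it the marker, to the end: rotateᵇ⁺¹ (frame K′) = (K′ + 1) 1 0.
-- So F(α) ends in 2 1 1, the two 1s are adjacent, and A₁(α) = 0.

module Submission where

open import Defs
open import Data.Nat using (ℕ; zero; suc; _≤_; _<_; _∸_; _+_; z≤n; s≤s; _≡ᵇ_; ⌊_/2⌋)
open import Data.Nat.Properties
  using (_≟_; _≤?_; ≤-total; ≤-trans; ≤-refl; ≤-reflexive; ≤-antisym; ≰⇒>; <⇒≤; suc-injective;
         +-comm; +-suc; +-identityʳ; m≤n⇒m⊓n≡m; m+n≤o⇒m≤o; m+n≤o⇒m≤o∸n; m≤n⇒m∸n≡0; m≤n+o⇒m∸n≤o;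
         m∸[m∸n]≡n; m+n∸n≡m)
open import Data.List
  using (List; []; _∷_; _++_; [_]; take; drop; length; reverse; map; upTo; break; replicate)
open import Data.Nat.ListAction using (sum)
open import Data.List.Properties
  using (∷-injective; ∷-injectiveˡ; ++-assoc; ++-identityʳ; ++-identityˡ-unique; ++-conicalʳ; map-++; length-++;
         length-map; map-injective; length-take; length-drop; take++drop≡id; span-defn;
         takeWhile++dropWhile; map-applyUpTo; unfold-reverse; reverse-map)
open import Data.List.Relation.Unary.All as All using (All; []; _∷_; universal)
import Data.List.Relation.Unary.All.Properties as All
open import Data.Product using (_×_; _,_; proj₁; proj₂; ∃; ∃₂; map₁; map₂; uncurry)
import Data.Product as Product
open import Data.Sum using (_⊎_; inj₁; inj₂)
open import Data.Bool using (true; false)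
open import Data.Empty using (⊥; ⊥-elim)
open import Function using (_∘_; id)
open import Relation.Nullary using (does; ¬?; yes; no; contradiction)
open import Relation.Unary using (Pred; Decidable; ∁)
open import Relation.Binary.PropositionalEquality
  using (_≡_; _≢_; refl; sym; trans; cong; cong₂; subst; module ≡-Reasoning)
open ≡-Reasoning

module _ {a p} {A : Set a} {P : Pred A p} (P? : Decidable P) where

  break-++≡id : ∀ xs → uncurry _++_ (break P? xs) ≡ xs
  break-++≡id xs =
    trans (cong (uncurry _++_) (span-defn (¬? ∘ P?) xs)) (takeWhile++dropWhile (¬? ∘ P?) xs)

  break-none : ∀ {xs} → All (∁ P) xs → proj₂ (break P? xs) ≡ []
  break-none [] = refl
  break-none {x ∷ _} (¬px ∷ ¬pxs) with P? x
  ... | yes px = contradiction px ¬px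
  ... | no _   = break-none ¬pxs

  break-++-found : ∀ xs ys → proj₂ (break P? xs) ≢ [] →
    break P? (xs ++ ys) ≡ map₂ (_++ ys) (break P? xs)
  break-++-found []       ys found = ⊥-elim (found refl)
  break-++-found (x ∷ xs) ys found with does (P? x)
  ... | true  = refl
  ... | false = cong (map₁ (x ∷_)) (break-++-found xs ys found)

  break-++-notFound : ∀ xs ys → proj₂ (break P? xs) ≡ [] →
    break P? (xs ++ ys) ≡ map₁ (xs ++_) (break P? ys)
  break-++-notFound []       ys _ = refl
  break-++-notFound (x ∷ xs) ys none with does (P? x)
  break-++-notFound (x ∷ xs) ys () | true
  ... | false = cong (map₁ (x ∷_)) (break-++-notFound xs ys none)

break-map-suc : ∀ t xs →
  break (_≟ suc t) (map suc xs) ≡ Product.map (map suc) (map suc) (break (_≟ t) xs)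
break-map-suc t []       = refl
break-map-suc t (x ∷ xs) with x ≡ᵇ t
... | true  = refl
... | false = cong (map₁ (suc x ∷_)) (break-map-suc t xs)

swapJoin : List ℕ × List ℕ → List ℕ
swapJoin (X , Y) = Y ++ X

-- The middle-block move of the nest recursion: M = X | Y with Y starting at the first c+1.
rotate : List ℕ → List ℕ
rotate []      = []
rotate (c ∷ m) = swapJoin (break (_≟ suc c) (c ∷ m))

rotate^ : ℕ → List ℕ → List ℕ
rotate^ zero    L = L
rotate^ (suc n) L = rotate (rotate^ n L)

rotate^-suc : ∀ n L → rotate^ (suc n) L ≡ rotate^ n (rotate L)
rotate^-suc zero    L = refl
rotate^-suc (suc n) L = cong rotate (rotate^-suc n L)

rotate-map-suc : ∀ L → rotate (map suc L) ≡ map suc (rotate L)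
rotate-map-suc []      = refl
rotate-map-suc (c ∷ m) rewrite break-map-suc (suc c) (c ∷ m) =
  sym (map-++ suc (proj₂ (break (_≟ suc c) (c ∷ m))) (proj₁ (break (_≟ suc c) (c ∷ m))))

take-length-++ : ∀ {a} {A : Set a} (xs ys : List A) → take (length xs) (xs ++ ys) ≡ xs
take-length-++ []       ys = refl
take-length-++ (x ∷ xs) ys = cong (x ∷_) (take-length-++ xs ys)

drop-length-++ : ∀ {a} {A : Set a} (xs ys : List A) → drop (length xs) (xs ++ ys) ≡ ys
drop-length-++ []       ys = refl
drop-length-++ (x ∷ xs) ys = drop-length-++ xs ys

cutStep : List ℕ → List ℕ → List ℕ → List ℕ → List ℕ
cutStep L W []      Z = L
cutStep L W (c ∷ m) Z = W ++ rotate (c ∷ m) ++ Z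

step-cut : ∀ i L →
  step i L ≡ cutStep L (take i L) (take (length (drop i L) ∸ i) (drop i L))
                                  (drop (length (drop i L) ∸ i) (drop i L))
step-cut i L with take i L | drop i L
... | W | R with take (length R ∸ i) R | drop (length R ∸ i) R
...   | []    | Z = refl
...   | c ∷ m | Z with break (λ x → x ≟ suc c) (c ∷ m)
...     | X , Y = cong (W ++_) (sym (++-assoc Y X Z))

step-trisection : ∀ W M Z → length Z ≡ length W →
  step (length W) (W ++ M ++ Z) ≡ W ++ rotate M ++ Z
step-trisection W M Z eZ = begin
  step (length W) L
    ≡⟨ step-cut (length W) L ⟩
  cutStep L (take (length W) L) (take (n (drop (length W) L)) (drop (length W) L))
                                (drop (n (drop (length W) L)) (drop (length W) L))
    ≡⟨ cong₂ (λ W′ R → cutStep L W′ (take (n R) R) (drop (n R) R))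
             (take-length-++ W (M ++ Z)) (drop-length-++ W (M ++ Z)) ⟩
  cutStep L W (take (n (M ++ Z)) (M ++ Z)) (drop (n (M ++ Z)) (M ++ Z))
    ≡⟨ cong (λ m → cutStep L W (take m (M ++ Z)) (drop m (M ++ Z))) middle-length ⟩
  cutStep L W (take (length M) (M ++ Z)) (drop (length M) (M ++ Z))
    ≡⟨ cong₂ (cutStep L W) (take-length-++ M Z) (drop-length-++ M Z) ⟩
  cutStep L W M Z
    ≡⟨ cutStep-++ M ⟩
  W ++ rotate M ++ Z ∎
  where
    L : List ℕ
    L = W ++ M ++ Z
    n : List ℕ → ℕ
    n R = length R ∸ length W
    middle-length : n (M ++ Z) ≡ length M
    middle-length = trans (cong₂ _∸_ (length-++ M) (sym eZ)) (m+n∸n≡m (length M) (length Z))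
    cutStep-++ : ∀ M → cutStep (W ++ M ++ Z) W M Z ≡ W ++ rotate M ++ Z
    cutStep-++ []      = refl
    cutStep-++ (c ∷ m) = refl

step-short : ∀ i L → length L ≤ i + i → step i L ≡ L
step-short i L short =
  trans (step-cut i L) (cong (λ m → cutStep L (take i L) (take m R) (drop m R)) no-middle)
  where
    R : List ℕ
    R = drop i L
    no-middle : length R ∸ i ≡ 0
    no-middle = trans (cong (_∸ i) (length-drop i L))
                      (m≤n⇒m∸n≡0 (m≤n+o⇒m∸n≤o (length L) i short))

trisect : ∀ i (L : List ℕ) → i + i ≤ length L →
  ∃₂ λ W M → ∃ λ Z → L ≡ W ++ M ++ Z × length W ≡ i × length Z ≡ i
trisect i L long = take i L , take n R , drop n R , split , length-W , length-Z
  where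
    R : List ℕ
    R = drop i L
    n : ℕ
    n = length R ∸ i
    split : L ≡ take i L ++ take n R ++ drop n R
    split = sym (trans (cong (take i L ++_) (take++drop≡id n R)) (take++drop≡id i L))
    length-W : length (take i L) ≡ i
    length-W = trans (length-take i L) (m≤n⇒m⊓n≡m (m+n≤o⇒m≤o i long))
    length-Z : length (drop n R) ≡ i
    length-Z = trans (length-drop n R)
      (m∸[m∸n]≡n (≤-trans (m+n≤o⇒m≤o∸n i long) (≤-reflexive (sym (length-drop i L)))))

frame : List ℕ → List ℕ
frame L = 0 ∷ map suc L ++ [ 1 ]

length-frame : ∀ L → length (frame L) ≡ suc (suc (length L))
length-frame L = cong suc (trans (length-++ (map suc L)) (trans (+-comm (length (map suc L)) 1)
                                                               (cong suc (length-map suc L))))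

frame-++ : ∀ W M Z → frame (W ++ M ++ Z) ≡ (0 ∷ map suc W) ++ map suc M ++ map suc Z ++ [ 1 ]
frame-++ W M Z = cong (0 ∷_) (begin
  map suc (W ++ M ++ Z) ++ [ 1 ]
    ≡⟨ cong (_++ [ 1 ]) (trans (map-++ suc W (M ++ Z)) (cong (map suc W ++_) (map-++ suc M Z))) ⟩
  (map suc W ++ map suc M ++ map suc Z) ++ [ 1 ]
    ≡⟨ ++-assoc (map suc W) (map suc M ++ map suc Z) [ 1 ] ⟩
  map suc W ++ (map suc M ++ map suc Z) ++ [ 1 ]
    ≡⟨ cong (map suc W ++_) (++-assoc (map suc M) (map suc Z) [ 1 ]) ⟩
  map suc W ++ map suc M ++ map suc Z ++ [ 1 ] ∎)

step-frame : ∀ i L → step (suc i) (frame L) ≡ frame (step i L)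
step-frame i L with ≤-total (i + i) (length L)
... | inj₂ short =
  trans (step-short (suc i) (frame L) framed-short) (cong frame (sym (step-short i L short)))
  where
    framed-short : length (frame L) ≤ suc i + suc i
    framed-short = ≤-trans (≤-reflexive (length-frame L))
                           (s≤s (≤-trans (s≤s short) (≤-reflexive (sym (+-suc i i)))))
... | inj₁ long with trisect i L long
...   | W , M , Z , refl , refl , eZ = begin
  step (suc (length W)) (frame (W ++ M ++ Z))
    ≡⟨ cong (step (suc (length W))) (frame-++ W M Z) ⟩
  step (suc (length W)) ((0 ∷ map suc W) ++ map suc M ++ map suc Z ++ [ 1 ])
    ≡⟨ cong (λ n → step (suc n) ((0 ∷ map suc W) ++ map suc M ++ map suc Z ++ [ 1 ]))
            (sym (length-map suc W)) ⟩
  step (length (0 ∷ map suc W)) ((0 ∷ map suc W) ++ map suc M ++ map suc Z ++ [ 1 ])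
    ≡⟨ step-trisection (0 ∷ map suc W) (map suc M) (map suc Z ++ [ 1 ]) length-Z ⟩
  (0 ∷ map suc W) ++ rotate (map suc M) ++ map suc Z ++ [ 1 ]
    ≡⟨ cong (λ N → (0 ∷ map suc W) ++ N ++ map suc Z ++ [ 1 ]) (rotate-map-suc M) ⟩
  (0 ∷ map suc W) ++ map suc (rotate M) ++ map suc Z ++ [ 1 ]
    ≡⟨ frame-++ W (rotate M) Z ⟨
  frame (W ++ rotate M ++ Z)
    ≡⟨ cong frame (step-trisection W M Z eZ) ⟨
  frame (step (length W) (W ++ M ++ Z)) ∎
  where
    length-Z : length (map suc Z ++ [ 1 ]) ≡ length (0 ∷ map suc W)
    length-Z = begin
      length (map suc Z ++ [ 1 ])  ≡⟨ length-++ (map suc Z) ⟩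
      length (map suc Z) + 1       ≡⟨ +-comm (length (map suc Z)) 1 ⟩
      suc (length (map suc Z))     ≡⟨ cong suc (length-map suc Z) ⟩
      suc (length Z)               ≡⟨ cong suc eZ ⟩
      suc (length W)               ≡⟨ cong suc (length-map suc W) ⟨
      suc (length (map suc W))     ∎

step-one-frame : ∀ L → step 1 (frame L) ≡ frame (rotate L)
step-one-frame L = trans (step-trisection [ 0 ] (map suc L) [ 1 ] refl)
                         (cong (λ N → 0 ∷ N ++ [ 1 ]) (rotate-map-suc L))

upTo-suc : ∀ n → upTo (suc n) ≡ 0 ∷ map suc (upTo n)
upTo-suc n = cong (0 ∷_) (sym (map-applyUpTo id suc n))

baseNest-frame : ∀ k → baseNest (suc k) ≡ frame (baseNest k)
baseNest-frame k = begin
  upTo (suc (suc k)) ++ reverse (map suc (upTo (suc k)))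
    ≡⟨ cong₂ (λ U V → U ++ reverse (map suc V)) (upTo-suc (suc k)) (upTo-suc k) ⟩
  0 ∷ U ++ reverse (1 ∷ map suc V)
    ≡⟨ cong (λ N → 0 ∷ U ++ N) (unfold-reverse 1 (map suc V)) ⟩
  0 ∷ U ++ reverse (map suc V) ++ [ 1 ]
    ≡⟨ cong (λ N → 0 ∷ U ++ N ++ [ 1 ]) (reverse-map suc V) ⟨
  0 ∷ U ++ map suc (reverse V) ++ [ 1 ]
    ≡⟨ cong (0 ∷_) (++-assoc U (map suc (reverse V)) [ 1 ]) ⟨
  0 ∷ (U ++ map suc (reverse V)) ++ [ 1 ]
    ≡⟨ cong (λ N → 0 ∷ N ++ [ 1 ]) (map-++ suc (upTo (suc k)) (reverse V)) ⟨
  frame (baseNest k) ∎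
  where
    U = map suc (upTo (suc k))
    V = map suc (upTo k)

nestFuel-frame : ∀ k n α → nestFuel (suc k) n (0 ∷ α) ≡ frame (nestFuel k n α)
nestFuel-frame k zero    α = baseNest-frame k
nestFuel-frame k (suc n) α with allZero α
... | true  = baseNest-frame k
... | false = trans (cong (step (suc (iIdx α))) (nestFuel-frame k n (parent α)))
                    (step-frame (iIdx α) (nestFuel k n (parent α)))

F-zero∷ : ∀ k α → F (suc k) (0 ∷ α) ≡ frame (F k α)
F-zero∷ k α = nestFuel-frame k (sum α) α

F-∷ : ∀ k m α → F (suc k) (m ∷ α) ≡ frame (rotate^ m (F k α))
F-∷ k zero    α = F-zero∷ k α
F-∷ k (suc m) α = trans (cong (step 1) (F-∷ k m α)) (step-one-frame (rotate^ m (F k α)))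

F-framed : ∀ k α → ∃ λ W → F (suc k) α ≡ frame W
F-framed k []      = baseNest k , baseNest-frame k
F-framed k (m ∷ α) = rotate^ m (F k α) , F-∷ k m α

ZeroFree : List ℕ → Set
ZeroFree = All (_≢ 0)

ZeroFree-map-suc : ∀ L → ZeroFree (map suc L)
ZeroFree-map-suc L = All.map⁺ (universal (λ _ ()) L)

OneZero : List ℕ → Set
OneZero L = ∃₂ λ A B → L ≡ A ++ 0 ∷ B × ZeroFree A × ZeroFree B

zero-prefix-unique : ∀ {A A′ B B′} → ZeroFree A → ZeroFree A′ →
  A ++ 0 ∷ B ≡ A′ ++ 0 ∷ B′ → A ≡ A′
zero-prefix-unique []          []           _ = refl
zero-prefix-unique []          (a′≢0 ∷ _)   e = ⊥-elim (a′≢0 (sym (∷-injectiveˡ e)))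
zero-prefix-unique (a≢0 ∷ _)   []           e = ⊥-elim (a≢0 (∷-injectiveˡ e))
zero-prefix-unique {a ∷ _} (_ ∷ zA) (_ ∷ zA′) e with ∷-injective e
... | refl , e′ = cong (a ∷_) (zero-prefix-unique zA zA′ e′)

zero-in-++ : ∀ P {Q} A {B} → P ++ Q ≡ A ++ 0 ∷ B →
  (∃ λ T → P ≡ A ++ 0 ∷ T × B ≡ T ++ Q) ⊎ (∃ λ T → Q ≡ T ++ 0 ∷ B × A ≡ P ++ T)
zero-in-++ []      A       e = inj₂ (A , e , refl)
zero-in-++ (p ∷ P) []      e with ∷-injective e
... | refl , e′ = inj₁ (P , refl , sym e′)
zero-in-++ (p ∷ P) (a ∷ A) e with ∷-injective e
... | refl , e′ with zero-in-++ P A e′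
...   | inj₁ (T , P-split , B-split) = inj₁ (T , cong (p ∷_) P-split , B-split)
...   | inj₂ (T , Q-split , A-split) = inj₂ (T , Q-split , cong (p ∷_) A-split)

-- If the zero sits in P, it moves right by |Q| in Q ++ P; if it sits in Q, it moves left by |P|.
commuting-one-zero : ∀ P Q → OneZero (P ++ Q) → P ++ Q ≡ Q ++ P → P ≡ [] ⊎ Q ≡ []
commuting-one-zero P Q (A , B , e , zA , zB) comm with zero-in-++ P A e
... | inj₁ (T , refl , refl) =
  inj₂ (++-identityˡ-unique Q (zero-prefix-unique zA (All.++⁺ (All.++⁻ʳ T zB) zA)
    (trans (sym e) (trans comm (sym (++-assoc Q A (0 ∷ T)))))))
... | inj₂ (T , refl , refl) =
  inj₁ (++-identityˡ-unique P (sym (zero-prefix-unique zA (All.++⁻ʳ P zA)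
    (trans (sym e) (trans comm (++-assoc T (0 ∷ B) P))))))

mark : List ℕ → List ℕ → List ℕ
mark P Q = map suc P ++ 1 ∷ 0 ∷ map suc Q

-- M is L shifted up by one with the marker 1 0 inserted at the seam after which L reads
-- cyclically as C.
record Marked (L M C : List ℕ) : Set where
  constructor marked
  field
    front back : List ℕ
    L-split    : L ≡ front ++ back
    M-split    : M ≡ mark front back
    cycle      : back ++ front ≡ C
    front≢[]   : front ≢ []

module _ (c : ℕ) (p Q : List ℕ) where
  private
    X Y X′ Y′ D : List ℕ
    X  = proj₁ (break (_≟ suc c) (c ∷ p))
    Y  = proj₂ (break (_≟ suc c) (c ∷ p))
    X′ = proj₁ (break (_≟ suc c) Q)
    Y′ = proj₂ (break (_≟ suc c) Q)
    D  = 1 ∷ 0 ∷ map suc Q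
    shifted : break (_≟ suc (suc c)) (map suc (c ∷ p)) ≡ (map suc X , map suc Y)
    shifted = break-map-suc (suc c) (c ∷ p)

  rotate-Marked-found : Y ≢ [] →
    Marked (rotate (c ∷ p ++ Q)) (rotate (mark (c ∷ p) Q)) (Q ++ c ∷ p)
  rotate-Marked-found Y≢[] = marked Y (Q ++ X) L-split M-split cycle Y≢[]
    where
      L-split : rotate (c ∷ p ++ Q) ≡ Y ++ Q ++ X
      L-split = trans (cong swapJoin (break-++-found (_≟ suc c) (c ∷ p) Q Y≢[])) (++-assoc Y Q X)
      M-split : rotate (mark (c ∷ p) Q) ≡ mark Y (Q ++ X)
      M-split = begin
        swapJoin (break (_≟ suc (suc c)) (map suc (c ∷ p) ++ D))
          ≡⟨ cong swapJoin (break-++-found (_≟ suc (suc c)) (map suc (c ∷ p)) D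
               (λ e → Y≢[] (map-injective suc-injective (trans (sym (cong proj₂ shifted)) e)))) ⟩
        swapJoin (map₂ (_++ D) (break (_≟ suc (suc c)) (map suc (c ∷ p))))
          ≡⟨ cong (swapJoin ∘ map₂ (_++ D)) shifted ⟩
        (map suc Y ++ D) ++ map suc X
          ≡⟨ ++-assoc (map suc Y) D (map suc X) ⟩
        map suc Y ++ 1 ∷ 0 ∷ map suc Q ++ map suc X
          ≡⟨ cong (λ N → map suc Y ++ 1 ∷ 0 ∷ N) (map-++ suc Q X) ⟨
        mark Y (Q ++ X) ∎
      cycle : (Q ++ X) ++ Y ≡ Q ++ c ∷ p
      cycle = trans (++-assoc Q X Y) (cong (Q ++_) (break-++≡id (_≟ suc c) (c ∷ p)))

  rotate-Marked-notFound : Y ≡ [] →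
    Marked (rotate (c ∷ p ++ Q)) (rotate (mark (c ∷ p) Q)) (Q ++ c ∷ p)
  rotate-Marked-notFound Y≡[] = marked (Y′ ++ c ∷ p) X′ L-split M-split cycle
                                       (λ e → contradiction (++-conicalʳ Y′ (c ∷ p) e) λ ())
    where
      L-split : rotate (c ∷ p ++ Q) ≡ (Y′ ++ c ∷ p) ++ X′
      L-split = trans (cong swapJoin (break-++-notFound (_≟ suc c) (c ∷ p) Q Y≡[]))
                      (sym (++-assoc Y′ (c ∷ p) X′))
      M-split : rotate (mark (c ∷ p) Q) ≡ mark (Y′ ++ c ∷ p) X′
      M-split = begin
        swapJoin (break (_≟ suc (suc c)) (map suc (c ∷ p) ++ D))
          ≡⟨ cong swapJoin (break-++-notFound (_≟ suc (suc c)) (map suc (c ∷ p)) D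
               (trans (cong proj₂ shifted) (cong (map suc) Y≡[]))) ⟩
        swapJoin (map₁ (map suc (c ∷ p) ++_) (break (_≟ suc (suc c)) D))
          ≡⟨ cong (swapJoin ∘ map₁ (λ N → map suc (c ∷ p) ++ 1 ∷ 0 ∷ N)) (break-map-suc (suc c) Q) ⟩
        map suc Y′ ++ map suc (c ∷ p) ++ 1 ∷ 0 ∷ map suc X′
          ≡⟨ ++-assoc (map suc Y′) (map suc (c ∷ p)) (1 ∷ 0 ∷ map suc X′) ⟨
        (map suc Y′ ++ map suc (c ∷ p)) ++ 1 ∷ 0 ∷ map suc X′
          ≡⟨ cong (_++ 1 ∷ 0 ∷ map suc X′) (map-++ suc Y′ (c ∷ p)) ⟨
        mark (Y′ ++ c ∷ p) X′ ∎
      cycle : X′ ++ Y′ ++ c ∷ p ≡ Q ++ c ∷ p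
      cycle = trans (sym (++-assoc X′ Y′ (c ∷ p))) (cong (_++ c ∷ p) (break-++≡id (_≟ suc c) Q))

rotate-Marked : ∀ {L M C} → Marked L M C → Marked (rotate L) (rotate M) C
rotate-Marked (marked []      Q _    _    _    front≢[]) = ⊥-elim (front≢[] refl)
rotate-Marked (marked (c ∷ p) Q refl refl refl _) with proj₂ (break (_≟ suc c) (c ∷ p)) in Y≡
... | []    = rotate-Marked-notFound c p Q Y≡
... | _ ∷ _ = rotate-Marked-found c p Q (subst (_≢ []) (sym Y≡) λ ())

rotate^-Marked : ∀ n {L M C} → Marked L M C → Marked (rotate^ n L) (rotate^ n M) C
rotate^-Marked zero    m = m
rotate^-Marked (suc n) m = rotate-Marked (rotate^-Marked n m)

Marked-self : ∀ {L M} → Marked L M L → OneZero L → M ≡ mark L []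
Marked-self (marked P Q refl refl cycle P≢[]) oz with commuting-one-zero P Q oz (sym cycle)
... | inj₁ P≡[] = ⊥-elim (P≢[] P≡[])
... | inj₂ refl = cong (λ N → mark N []) (sym (++-identityʳ P))

rotate^-conjugate : ∀ n P → P ≢ [] → ∃₂ λ X Y → rotate^ n P ≡ X ++ Y × Y ++ X ≡ P
rotate^-conjugate n P P≢[] with rotate^-Marked n (marked P [] (sym (++-identityʳ P)) refl refl P≢[])
... | marked X Y L-split _ cycle _ = X , Y , L-split , cycle

zero-headed-conjugate : ∀ {T} X Y → Y ++ X ≡ 0 ∷ T → ∃₂ λ P Q → X ++ Y ≡ Q ++ 0 ∷ P × P ++ Q ≡ T
zero-headed-conjugate {T} X []        refl = T , [] , ++-identityʳ (0 ∷ T) , ++-identityʳ T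
zero-headed-conjugate     X (.0 ∷ Y′) refl = Y′ , X , refl , refl

rotate-frame-at-zero : ∀ Q P → ZeroFree Q → rotate (frame (Q ++ 0 ∷ P)) ≡ mark (0 ∷ P) Q
rotate-frame-at-zero Q P zQ = begin
  rotate (0 ∷ map suc (Q ++ 0 ∷ P) ++ [ 1 ])
    ≡⟨ cong (rotate ∘ (0 ∷_)) (trans (cong (_++ [ 1 ]) (map-++ suc Q (0 ∷ P)))
                                      (++-assoc (map suc Q) (1 ∷ map suc P) [ 1 ])) ⟩
  rotate ((0 ∷ map suc Q) ++ R)
    ≡⟨ cong swapJoin (break-++-notFound (_≟ 1) (0 ∷ map suc Q) R no-one) ⟩
  R ++ 0 ∷ map suc Q ++ []
    ≡⟨ cong (λ N → R ++ 0 ∷ N) (++-identityʳ (map suc Q)) ⟩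
  R ++ 0 ∷ map suc Q
    ≡⟨ cong (1 ∷_) (++-assoc (map suc P) [ 1 ] (0 ∷ map suc Q)) ⟩
  mark (0 ∷ P) Q ∎
  where
    R : List ℕ
    R = 1 ∷ map suc P ++ [ 1 ]
    no-one : proj₂ (break (_≟ 1) (0 ∷ map suc Q)) ≡ []
    no-one = break-none (_≟ 1) {0 ∷ map suc Q}
               ((λ ()) ∷ All.map⁺ (All.map (λ q≢0 → q≢0 ∘ suc-injective) zQ))

rotate^-frame : ∀ n T → ZeroFree T →
  rotate^ (suc n) (frame (rotate^ n (0 ∷ T))) ≡ mark (rotate^ n (0 ∷ T)) []
rotate^-frame n T zT with rotate^-conjugate n (0 ∷ T) (λ ())
... | X , Y , K′-split , cycle with zero-headed-conjugate X Y cycle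
...   | P , Q , XY-split , PQ≡T = begin
  rotate^ (suc n) (frame K′)
    ≡⟨ rotate^-suc n (frame K′) ⟩
  rotate^ n (rotate (frame K′))
    ≡⟨ cong (rotate^ n ∘ rotate ∘ frame) K′-at-zero ⟩
  rotate^ n (rotate (frame (Q ++ 0 ∷ P)))
    ≡⟨ cong (rotate^ n) (rotate-frame-at-zero Q P zQ) ⟩
  rotate^ n (mark (0 ∷ P) Q)
    ≡⟨ Marked-self (rotate^-Marked n start) (Q , P , K′-at-zero , zQ , zP) ⟩
  mark K′ [] ∎
  where
    K′ : List ℕ
    K′ = rotate^ n (0 ∷ T)
    K′-at-zero : K′ ≡ Q ++ 0 ∷ P
    K′-at-zero = trans K′-split XY-split
    zPQ : ZeroFree (P ++ Q)
    zPQ = subst ZeroFree (sym PQ≡T) zT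
    zP : ZeroFree P
    zP = All.++⁻ˡ P zPQ
    zQ : ZeroFree Q
    zQ = All.++⁻ʳ P zPQ
    start : Marked (0 ∷ T) (mark (0 ∷ P) Q) K′
    start = marked (0 ∷ P) Q (cong (0 ∷_) (sym PQ≡T)) refl (sym K′-at-zero) (λ ())

AdjacentPair : List ℕ → Set
AdjacentPair ps = ∃ λ p → ps ≡ p ∷ suc p ∷ []

AdjacentPair-map-suc : ∀ {ps} → AdjacentPair ps → AdjacentPair (map suc ps)
AdjacentPair-map-suc (p , refl) = suc p , refl

sigA-adjacent : ∀ k j α → AdjacentPair (positionsFrom j 0 (F k α)) → sigA k j α ≡ 0
sigA-adjacent k j α (p , eq) rewrite eq = cong ⌊_/2⌋ (m+n∸n≡m 1 p)

positionsFrom-suc : ∀ j o L → positionsFrom j (suc o) L ≡ map suc (positionsFrom j o L)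
positionsFrom-suc j o []      = refl
positionsFrom-suc j o (x ∷ L) with x ≟ j
... | yes _ = cong (suc o ∷_) (positionsFrom-suc j (suc o) L)
... | no  _ = positionsFrom-suc j (suc o) L

positionsFrom-map-suc : ∀ j o L → positionsFrom (suc j) o (map suc L) ≡ positionsFrom j o L
positionsFrom-map-suc j o []      = refl
positionsFrom-map-suc j o (x ∷ L) with suc x ≟ suc j | x ≟ j
... | yes _     | yes _   = cong (o ∷_) (positionsFrom-map-suc j (suc o) L)
... | no  _     | no  _   = positionsFrom-map-suc j (suc o) L
... | yes sx≡sj | no x≢j  = contradiction (suc-injective sx≡sj) x≢j
... | no  sx≢sj | yes x≡j = contradiction (cong suc x≡j) sx≢sj

positionsFrom-∷ʳ-absent : ∀ {x j} o L → x ≢ j → positionsFrom j o (L ++ [ x ]) ≡ positionsFrom j o L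
positionsFrom-∷ʳ-absent {x} {j} o [] x≢j with x ≟ j
... | yes x≡j = contradiction x≡j x≢j
... | no  _   = refl
positionsFrom-∷ʳ-absent {j = j} o (y ∷ L) x≢j with y ≟ j
... | yes _ = cong (o ∷_) (positionsFrom-∷ʳ-absent (suc o) L x≢j)
... | no  _ = positionsFrom-∷ʳ-absent (suc o) L x≢j

positionsFrom-++-absent : ∀ {j} o L M → All (_≢ j) L →
  positionsFrom j o (L ++ M) ≡ positionsFrom j (o + length L) M
positionsFrom-++-absent {j} o []      M []          = cong (λ n → positionsFrom j n M) (sym (+-identityʳ o))
positionsFrom-++-absent {j} o (y ∷ L) M (y≢j ∷ L≢j) with y ≟ j
... | yes y≡j = contradiction y≡j y≢j
... | no  _   = trans (positionsFrom-++-absent (suc o) L M L≢j)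
                      (cong (λ n → positionsFrom j n M) (sym (+-suc o (length L))))

positionsFrom-frame : ∀ j L → positionsFrom (suc (suc j)) 0 (frame L) ≡ map suc (positionsFrom (suc j) 0 L)
positionsFrom-frame j L = begin
  positionsFrom (suc (suc j)) 1 (map suc L ++ [ 1 ]) ≡⟨ positionsFrom-∷ʳ-absent 1 (map suc L) (λ ()) ⟩
  positionsFrom (suc (suc j)) 1 (map suc L)          ≡⟨ positionsFrom-map-suc (suc j) 1 L ⟩
  positionsFrom (suc j) 1 L                          ≡⟨ positionsFrom-suc (suc j) 0 L ⟩
  map suc (positionsFrom (suc j) 0 L)                ∎

adjacent-ones-in-frame : ∀ L → AdjacentPair (positionsFrom 1 0 (frame (mark L [])))
adjacent-ones-in-frame L = suc (1 + length L₂) , (begin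
  positionsFrom 1 1 (map suc (L₁ ++ 1 ∷ 0 ∷ []) ++ [ 1 ])
    ≡⟨ cong (positionsFrom 1 1) (trans (cong (_++ [ 1 ]) (map-++ suc L₁ (1 ∷ 0 ∷ [])))
                                      (++-assoc L₂ (2 ∷ 1 ∷ []) [ 1 ])) ⟩
  positionsFrom 1 1 (L₂ ++ 2 ∷ 1 ∷ 1 ∷ [])
    ≡⟨ positionsFrom-++-absent 1 L₂ (2 ∷ 1 ∷ 1 ∷ [])
         (All.map⁺ (All.map⁺ (universal (λ _ ()) L))) ⟩
  positionsFrom 1 (1 + length L₂) (2 ∷ 1 ∷ 1 ∷ []) ∎)
  where
    L₁ L₂ : List ℕ
    L₁ = map suc L
    L₂ = map suc L₁

adjacent-ones : ∀ k b β → AdjacentPair (positionsFrom 1 0 (F (3 + k) (suc b ∷ b ∷ β)))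
adjacent-ones k b β with F-framed k β
... | W , H≡ = subst (AdjacentPair ∘ positionsFrom 1 0) (sym F≡) (adjacent-ones-in-frame K′)
  where
    T K′ : List ℕ
    T  = map suc W ++ [ 1 ]
    K′ = rotate^ b (0 ∷ T)
    F≡ : F (3 + k) (suc b ∷ b ∷ β) ≡ frame (mark K′ [])
    F≡ = begin
      F (3 + k) (suc b ∷ b ∷ β)
        ≡⟨ F-∷ (2 + k) (suc b) (b ∷ β) ⟩
      frame (rotate^ (suc b) (F (2 + k) (b ∷ β)))
        ≡⟨ cong (frame ∘ rotate^ (suc b)) (F-∷ (suc k) b β) ⟩
      frame (rotate^ (suc b) (frame (rotate^ b (F (suc k) β))))
        ≡⟨ cong (λ H → frame (rotate^ (suc b) (frame (rotate^ b H)))) H≡ ⟩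
      frame (rotate^ (suc b) (frame K′))
        ≡⟨ cong frame (rotate^-frame b T (All.++⁺ (ZeroFree-map-suc W) ((λ ()) ∷ []))) ⟩
      frame (mark K′ []) ∎

adjacent-top : ∀ n → AdjacentPair (positionsFrom (suc n) 0 (F (2 + n) (replicate n 0 ++ [ 1 ])))
adjacent-top zero    = 3 , refl
adjacent-top (suc n)
  rewrite F-zero∷ (2 + n) (replicate n 0 ++ [ 1 ])
        | positionsFrom-frame n (F (2 + n) (replicate n 0 ++ [ 1 ]))
  = AdjacentPair-map-suc (adjacent-top n)

zeros-then-one : ∀ n α → length α ≡ suc n → entry α (suc n) ≡ 1 →
  (∀ j → 1 ≤ j → j ≤ n → entry α j ≡ 0) → α ≡ replicate n 0 ++ [ 1 ]
zeros-then-one zero    (a ∷ [])    _   a≡1 _     = cong [_] a≡1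
zeros-then-one (suc n) (a ∷ α)     len top zeros =
  cong₂ _∷_ (zeros 1 ≤-refl (s≤s z≤n))
            (zeros-then-one n α (suc-injective len) top
              (λ { (suc j) _ j≤n → zeros (2 + j) (s≤s z≤n) (s≤s j≤n) }))
zeros-then-one zero    []          ()  _   _
zeros-then-one zero    (_ ∷ _ ∷ _) ()  _   _
zeros-then-one (suc n) []          ()  _   _

iIdx-zeros-then-one : ∀ n → iIdx (replicate n 0 ++ [ 1 ]) ≡ suc n
iIdx-zeros-then-one zero    = refl
iIdx-zeros-then-one (suc n) = cong suc (iIdx-zeros-then-one n)

iIdx>1-shape : ∀ β → IsNonzero β → 1 < iIdx β → ∃₂ λ b β′ → β ≡ 0 ∷ b ∷ β′
iIdx>1-shape (zero ∷ b ∷ β′) _  _        = b , β′ , refl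
iIdx>1-shape []              _  ()
iIdx>1-shape (zero ∷ [])     () _
iIdx>1-shape (suc _ ∷ _)     _  (s≤s ())

child-at-one : ∀ {k t β} δ → IsChild k δ (t ∷ β) → iIdx δ ≡ 1 → δ ≡ suc t ∷ β
child-at-one (suc a ∷ δ)          (_ , _ , refl) _ = refl
child-at-one []                   (_ , () , _)   _
child-at-one (zero ∷ [])          (_ , () , _)   _
child-at-one (zero ∷ zero ∷ _)    _              ()
child-at-one (zero ∷ suc _ ∷ _)   _              ()

path-along-one : ∀ {k r β} (γ : ℕ → List ℕ) → γ zero ≡ 0 ∷ β →
  (∀ t → t < r → IsChild k (γ (suc t)) (γ t)) → (∀ t → 1 ≤ t → t ≤ r → iIdx (γ t) ≡ 1) →
  ∀ t → t ≤ r → γ t ≡ t ∷ β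
path-along-one γ γ₀ children ones zero    _   = γ₀
path-along-one {k} γ γ₀ children ones (suc t) t<r =
  child-at-one (γ (suc t))
    (subst (IsChild k (γ (suc t))) (path-along-one γ γ₀ children ones t (<⇒≤ t<r)) (children t t<r))
    (ones (suc t) (s≤s z≤n) t<r)

maximal-head : ∀ k r b β → IsGerm (3 + k) (r ∷ b ∷ β) →
  (∀ δ → IsChild (3 + k) δ (r ∷ b ∷ β) → iIdx δ ≡ 1 → ⊥) → r ≡ suc b
maximal-head k r b β (len , top , chain) maximal with r ≤? b
... | yes r≤b = ⊥-elim (maximal (suc r ∷ b ∷ β) ((len , top , chain′) , refl , refl) refl)
  where
    chain′ : ∀ i → 1 < i → i < 3 + k → entry (suc r ∷ b ∷ β) (i ∸ 1) ≤ entry (suc r ∷ b ∷ β) i + 1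
    chain′ (suc (suc zero))    _   _   = ≤-trans (s≤s r≤b) (≤-reflexive (+-comm 1 b))
    chain′ (suc (suc (suc i))) 1<i i<k = chain (3 + i) 1<i i<k
    chain′ (suc zero)          (s≤s ()) _
... | no r≰b =
  ≤-antisym (≤-trans (chain 2 (s≤s (s≤s z≤n)) (s≤s (s≤s (s≤s z≤n)))) (≤-reflexive (+-comm b 1)))
            (≰⇒> r≰b)

sigA-terminal≡0 : ∀ k r b β → IsGerm k (r ∷ b ∷ β) →
  (∀ δ → IsChild k δ (r ∷ b ∷ β) → iIdx δ ≡ 1 → ⊥) → sigA k (iIdx (r ∷ b ∷ β)) (r ∷ b ∷ β) ≡ 0
sigA-terminal≡0 (suc (suc (suc k))) r b β germ maximal with maximal-head k r b β germ maximal
... | refl = sigA-adjacent (3 + k) 1 (suc b ∷ b ∷ β) (adjacent-ones k b β)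
sigA-terminal≡0 zero             _ _ _ (() , _) _
sigA-terminal≡0 (suc zero)       _ _ _ (() , _) _
sigA-terminal≡0 (suc (suc zero)) _ _ _ (() , _) _

sigA-path-end≡0 : ∀ k α → IsGerm k α → (β : List ℕ) (r : ℕ) (γ : ℕ → List ℕ) →
  IsNonzero β → 1 < iIdx β → γ zero ≡ β → γ r ≡ α →
  (∀ t → t < r → IsChild k (γ (suc t)) (γ t)) →
  (∀ t → 1 ≤ t → t ≤ r → iIdx (γ t) ≡ 1) →
  (∀ δ → IsChild k δ α → iIdx δ ≡ 1 → ⊥) →
  sigA k (iIdx α) α ≡ 0
sigA-path-end≡0 k α germ β r γ nonzero deep γ₀ γᵣ children ones maximal with iIdx>1-shape β nonzero deep
... | b , β′ , refl with trans (sym γᵣ) (path-along-one γ γ₀ children ones r ≤-refl)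
...   | refl = sigA-terminal≡0 k r b β′ germ maximal

sigA-top-germ≡0 : ∀ k → 2 ≤ k → ∀ α → IsGerm k α → entry α (k ∸ 1) ≡ 1 →
  (∀ j → 1 ≤ j → j ≤ k ∸ 2 → entry α j ≡ 0) → sigA k (iIdx α) α ≡ 0
sigA-top-germ≡0 (suc (suc n)) _ α (len , _) top zeros with zeros-then-one n α len top zeros
... | refl rewrite iIdx-zeros-then-one n =
  sigA-adjacent (2 + n) (suc n) (replicate n 0 ++ [ 1 ]) (adjacent-top n)
sigA-top-germ≡0 (suc zero) (s≤s ())

theorem10 : (k : ℕ) → 2 ≤ k → (α : List ℕ) → IsGerm k α →
    ((β : List ℕ) (r : ℕ) (γ : ℕ → List ℕ) →
      IsGerm k β → IsNonzero β → 1 < iIdx β →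
      γ zero ≡ β → γ r ≡ α →
      (∀ t → t < r → IsChild k (γ (suc t)) (γ t)) →
      (∀ t → 1 ≤ t → t ≤ r → iIdx (γ t) ≡ 1) →
      (∀ δ → IsChild k δ α → iIdx δ ≡ 1 → ⊥) →
      sigA k (iIdx α) α ≡ 0)
    ×
    (entry α (k ∸ 1) ≡ 1 → (∀ j → 1 ≤ j → j ≤ k ∸ 2 → entry α j ≡ 0) →
      sigA k (iIdx α) α ≡ 0)
theorem10 k 2≤k α germ =
  (λ β r γ _ → sigA-path-end≡0 k α germ β r γ) , sigA-top-germ≡0 k 2≤k α germ
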